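{- Let $G$ be a finite group, $N$ a normal subgroup of $G$, and $A$ a $G$-module. Let $c \in H^2(G, A)$, and let $\alpha_N \in Z^2(G/N, A^N)$ be a $2$-cocycle in the cohomology class $\widetilde{\mathrm{AW}}(c) \in H^2(G/N, A^N)$, with $\alpha_N(1,1)=1$. Then there exists a $2$-cocycle $\alpha$ in the class $c$ such that $\alpha(1,1)=1$ and $\mathrm{AW}^2(\alpha)(\sigma,\tau) = \alpha_N(\bar\sigma,\tau)$ for all $\sigma \in G$, $\tau \in G/N$, where $\bar\sigma$ is the image of $\sigma$ in $G/N$.
   Context: The Akizuki–Witt map $\widetilde{\mathrm{AW}} : H^2(G,A) \rightarrow H^2(G/N, A^N)$ is defined as follows: choose a section $s : G/N \rightarrow G$ with $s(1)=1$; for $\alpha \in Z^2(G,A)$, $\widetilde{\mathrm{AW}}(\alpha)(\sigma,\tau) = \prod_{n \in N} n(\alpha(s(\sigma),s(\tau)))\,\alpha(n, s(\sigma)s(\tau))\,\alpha(n, s(\sigma\tau))^{ -1}$; this is a $2$-cocycle of $G/N$ with values in $A^N$ whose class depends only on the class of $\alpha$ (and not on $s$). For $\alpha : G \times G \rightarrow A$, $\mathrm{AW}^2(\alpha) : G \times G/N \rightarrow A$ is $\mathrm{AW}^2(\alpha)(\sigma,\tau) = \prod_{n \in N} \alpha(\sigma, n\tilde\tau)/\alpha(\sigma,n)$ where $\tilde\tau \in G$ is any lift of $\tau$. -}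

module Defs where

open import Level using (Level; _⊔_) renaming (suc to lsuc)
open import Algebra.Bundles using (Group; AbelianGroup)
open import Data.List using (List; foldr; filter)
open import Data.List.Relation.Unary.Any using (Any)
open import Data.List.Relation.Unary.AllPairs using (AllPairs)
open import Data.Product using (Σ; _×_)
open import Relation.Nullary using (¬_; Dec)
open import Relation.Unary using (Pred) renaming (Decidable to DecidableP)

record FiniteGroup (c ℓ : Level) : Set (lsuc (c ⊔ ℓ)) where
  field
    group : Group c ℓ
  open Group group public
  field
    _≟_      : (x y : Carrier) → Dec (x ≈ y)
    elements : List Carrier
    complete : ∀ x → Any (x ≈_) elements
    distinct : AllPairs (λ x y → ¬ (x ≈ y)) elements

record NormalSubgroup {c ℓ : Level} (G : FiniteGroup c ℓ) (n : Level)
       : Set (c ⊔ ℓ ⊔ lsuc n) where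
  open FiniteGroup G
  field
    mem    : Pred Carrier n
    mem?   : DecidableP mem
    resp   : ∀ {x y} → x ≈ y → mem x → mem y
    ε∈     : mem ε
    ∙∈     : ∀ {x y} → mem x → mem y → mem (x ∙ y)
    ⁻¹∈    : ∀ {x} → mem x → mem (x ⁻¹)
    normal : ∀ g {x} → mem x → mem ((g ∙ x) ∙ g ⁻¹)

record GModule {c ℓ : Level} (G : Group c ℓ) (a ℓa : Level)
       : Set (c ⊔ ℓ ⊔ lsuc (a ⊔ ℓa)) where
  private module G = Group G
  field
    abelian : AbelianGroup a ℓa
  open AbelianGroup abelian
  field
    act      : G.Carrier → Carrier → Carrier
    act-cong : ∀ {g h x y} → g G.≈ h → x ≈ y → act g x ≈ act h y
    act-ε    : ∀ x → act G.ε x ≈ x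
    act-∙    : ∀ g h x → act (g G.∙ h) x ≈ act g (act h x)
    act-hom  : ∀ g x y → act g (x ∙ y) ≈ act g x ∙ act g y

module Setup {c ℓ n a ℓa : Level} (G : FiniteGroup c ℓ) (N : NormalSubgroup G n)
             (M : GModule (FiniteGroup.group G) a ℓa) where
  open FiniteGroup G public
    using () renaming (Carrier to ∣G∣; _≈_ to _≈G_; _∙_ to _·_; ε to e; _⁻¹ to inv; elements to Gelements)
  open NormalSubgroup N public using (mem; mem?)
  open GModule M public using (act)
  open AbelianGroup (GModule.abelian M) public
    using () renaming (Carrier to ∣A∣; _≈_ to _≈A_; _∙_ to _*_; ε to 1A; _⁻¹ to _⁻¹)

  Cochain2 : Set (c ⊔ a)
  Cochain2 = ∣G∣ → ∣G∣ → ∣A∣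

  IsCochain2 : Cochain2 → Set (c ⊔ ℓ ⊔ ℓa)
  IsCochain2 α = ∀ {σ σ′ τ τ′} → σ ≈G σ′ → τ ≈G τ′ → α σ τ ≈A α σ′ τ′

  CocycleId : Cochain2 → Set (c ⊔ ℓa)
  CocycleId α = ∀ σ τ ρ → act σ (α τ ρ) * α σ (τ · ρ) ≈A α (σ · τ) ρ * α σ τ

  Z2 : Cochain2 → Set (c ⊔ ℓ ⊔ ℓa)
  Z2 α = IsCochain2 α × CocycleId α

  δ : (∣G∣ → ∣A∣) → Cochain2
  δ β σ τ = (act σ (β τ) * (β (σ · τ)) ⁻¹) * β σ

  Cohomologous : Cochain2 → Cochain2 → Set (c ⊔ ℓ ⊔ a ⊔ ℓa)
  Cohomologous α α′ =
    Σ (∣G∣ → ∣A∣) λ β →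
      (∀ {x y} → x ≈G y → β x ≈A β y) × (∀ σ τ → α′ σ τ ≈A α σ τ * δ β σ τ)

  -- The quotient G/N is represented by G with the coset relation  x ~ y :⇔ x⁻¹y ∈ N;
  -- functions on G/N are functions on G that are invariant under ~.
  _~_ : ∣G∣ → ∣G∣ → Set n
  x ~ y = mem (inv x · y)

  IsQuotCochain2 : Cochain2 → Set (c ⊔ n ⊔ ℓa)
  IsQuotCochain2 α = ∀ {σ σ′ τ τ′} → σ ~ σ′ → τ ~ τ′ → α σ τ ≈A α σ′ τ′

  NFixed2 : Cochain2 → Set (c ⊔ n ⊔ ℓa)
  NFixed2 α = ∀ σ τ m → mem m → act m (α σ τ) ≈A α σ τ

  ZQ2 : Cochain2 → Set (c ⊔ n ⊔ ℓa)
  ZQ2 α = IsQuotCochain2 α × NFixed2 α × CocycleId α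

  CohomologousQ : Cochain2 → Cochain2 → Set (c ⊔ n ⊔ a ⊔ ℓa)
  CohomologousQ α α′ =
    Σ (∣G∣ → ∣A∣) λ β →
      (∀ {x y} → x ~ y → β x ≈A β y)
      × (∀ x m → mem m → act m (β x) ≈A β x)
      × (∀ σ τ → α′ σ τ ≈A α σ τ * δ β σ τ)

  IsSection : (∣G∣ → ∣G∣) → Set (c ⊔ ℓ ⊔ n)
  IsSection s = (∀ {x y} → x ~ y → s x ≈G s y) × (∀ x → s x ~ x) × (s e ≈G e)

  prodN : (∣G∣ → ∣A∣) → ∣A∣
  prodN f = foldr (λ g acc → f g * acc) 1A (filter mem? Gelements)

  AWt : (∣G∣ → ∣G∣) → Cochain2 → Cochain2
  AWt s α σ τ = prodN (λ m →
    (act m (α (s σ) (s τ)) * α m (s σ · s τ)) * (α m (s (σ · τ))) ⁻¹)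

  AW2 : Cochain2 → Cochain2
  AW2 α σ τ = prodN (λ m → α σ (m · τ) * (α σ m) ⁻¹)

{-# OPTIONS --safe #-}

-- Write the given class as αN = AWt(α₀) · δβN.  For a cocycle α the cocycle identity gives
-- AW2(α) = AWt(α) · δ(Φ ∘ s)⁻¹ with Φ(y) = ∏_{m ∈ N} α(m, y), while for a coboundary
-- AW2(δβ)(σ, τ) = δB(σ, τ) · σB(1)⁻¹ with the coset product B(x) = ∏_{m ∈ N} β(m x).
-- So α = α₀ · δβ has AW2(α) = αN as soon as B = ((Φ · βN) ∘ s) · k for a constant k, and
-- such a β exists: let it be 1 off the fixed points of s, which meet each coset exactly
-- once.  Choosing k = α₀(1, 1)⁻¹ makes α(1, 1) = 1.  Products over N are reindexed along
-- the bijections m ↦ a m b of N with a b ∈ N, which exist because N is normal.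
module Submission where

open import Level using (_⊔_)
open import Algebra.Bundles using (Group; AbelianGroup)
import Algebra.Properties.AbelianGroup as AbelianGroupProperties
import Algebra.Properties.CommutativeSemigroup as CommutativeSemigroupProperties
import Algebra.Properties.Group as GroupProperties
import Algebra.Solver.CommutativeMonoid as CommutativeMonoidSolver
open import Data.Empty using (⊥-elim)
open import Data.List using (List; []; _∷_; foldr; filter)
import Data.List.Membership.Setoid as SetoidMembership
open import Data.List.Membership.Setoid.Properties using (∈-filter⁺)
open import Data.List.Relation.Unary.All as All using (All; []; _∷_)
open import Data.List.Relation.Unary.All.Properties using (All¬⇒¬Any; all-filter)
open import Data.List.Relation.Unary.AllPairs using (_∷_)
open import Data.List.Relation.Unary.Any as Any using (here; there)
open import Data.List.Relation.Unary.Unique.Setoid using (Unique)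
import Data.List.Relation.Unary.Unique.Setoid.Properties as UniqueProperties
open import Data.Product using (Σ; _×_; _,_; proj₁; proj₂)
open import Relation.Binary.Bundles using (Setoid)
open import Relation.Binary.Definitions using (Decidable)
import Relation.Binary.Reasoning.Setoid as ≈-Reasoning
open import Relation.Nullary using (¬_; Dec; yes; no)
open import Relation.Unary using (Pred)

open import Defs

module AbelianGroupAlgebra {a ℓ} (A : AbelianGroup a ℓ) where
  open AbelianGroup A
  open AbelianGroupProperties A using (⁻¹-∙-comm; ⁻¹-involutive; //-rightDividesʳ)
  open CommutativeSemigroupProperties commutativeSemigroup using (interchange)
  open CommutativeMonoidSolver commutativeMonoid using (solve; _⊜_; _⊕_)
  open ≈-Reasoning setoid

  ∙-/-interchange : ∀ x y z w → (x ∙ y) ∙ (z ∙ w) ⁻¹ ≈ (x ∙ z ⁻¹) ∙ (y ∙ w ⁻¹)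
  ∙-/-interchange x y z w = trans (∙-congˡ (sym (⁻¹-∙-comm z w))) (interchange x y (z ⁻¹) (w ⁻¹))

  cross-divide : ∀ {x y z w} → x ∙ y ≈ z ∙ w → y ∙ w ⁻¹ ≈ z ∙ x ⁻¹
  cross-divide {x} {y} {z} {w} xy≈zw = begin
    y ∙ w ⁻¹                   ≈⟨ //-rightDividesʳ x (y ∙ w ⁻¹) ⟨
    ((y ∙ w ⁻¹) ∙ x) ∙ x ⁻¹    ≈⟨ ∙-congʳ (solve 3 (λ x y w′ → (y ⊕ w′) ⊕ x ⊜ (x ⊕ y) ⊕ w′)
                                                   refl x y (w ⁻¹)) ⟩
    ((x ∙ y) ∙ w ⁻¹) ∙ x ⁻¹    ≈⟨ ∙-congʳ (∙-congʳ xy≈zw) ⟩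
    ((z ∙ w) ∙ w ⁻¹) ∙ x ⁻¹    ≈⟨ ∙-congʳ (//-rightDividesʳ w z) ⟩
    z ∙ x ⁻¹                   ∎

  cancel-across : ∀ x y z w u → ((x ∙ y ⁻¹) ∙ z) ∙ ((y ∙ w) ∙ u) ≈ (x ∙ z) ∙ (w ∙ u)
  cancel-across x y z w u = begin
    ((x ∙ y ⁻¹) ∙ z) ∙ ((y ∙ w) ∙ u)
      ≈⟨ solve 6 (λ x y′ z y w u →
                    ((x ⊕ y′) ⊕ z) ⊕ ((y ⊕ w) ⊕ u) ⊜ ((x ⊕ z) ⊕ (w ⊕ u)) ⊕ (y ⊕ y′))
               refl x (y ⁻¹) z y w u ⟩
    ((x ∙ z) ∙ (w ∙ u)) ∙ (y ∙ y ⁻¹) ≈⟨ ∙-congˡ (inverseʳ y) ⟩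
    ((x ∙ z) ∙ (w ∙ u)) ∙ ε          ≈⟨ identityʳ _ ⟩
    (x ∙ z) ∙ (w ∙ u)                ∎

  cancel-across′ : ∀ x y z w u → ((x ∙ w) ∙ y) ∙ ((z ∙ y ⁻¹) ∙ u) ≈ (x ∙ z) ∙ (w ∙ u)
  cancel-across′ x y z w u = begin
    ((x ∙ w) ∙ y) ∙ ((z ∙ y ⁻¹) ∙ u)
      ≈⟨ solve 6 (λ x w y z y′ u →
                    ((x ⊕ w) ⊕ y) ⊕ ((z ⊕ y′) ⊕ u) ⊜ ((x ⊕ z) ⊕ (w ⊕ u)) ⊕ (y ⊕ y′))
               refl x w y z (y ⁻¹) u ⟩
    ((x ∙ z) ∙ (w ∙ u)) ∙ (y ∙ y ⁻¹) ≈⟨ ∙-congˡ (inverseʳ y) ⟩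
    ((x ∙ z) ∙ (w ∙ u)) ∙ ε          ≈⟨ identityʳ _ ⟩
    (x ∙ z) ∙ (w ∙ u)                ∎

  /-cancelʳ : ∀ x y z → (x ∙ z) ∙ (y ∙ z) ⁻¹ ≈ x ∙ y ⁻¹
  /-cancelʳ x y z = begin
    (x ∙ z) ∙ (y ∙ z) ⁻¹      ≈⟨ ∙-/-interchange x z y z ⟩
    (x ∙ y ⁻¹) ∙ (z ∙ z ⁻¹)   ≈⟨ ∙-congˡ (inverseʳ z) ⟩
    (x ∙ y ⁻¹) ∙ ε            ≈⟨ identityʳ _ ⟩
    x ∙ y ⁻¹                  ∎

  /-/-rearrange : ∀ x y z w → (x ∙ y ⁻¹) ∙ (z ∙ w ⁻¹) ⁻¹ ≈ (x ∙ z ⁻¹) ∙ (w ∙ y ⁻¹)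
  /-/-rearrange x y z w = begin
    (x ∙ y ⁻¹) ∙ (z ∙ w ⁻¹) ⁻¹     ≈⟨ ∙-/-interchange x (y ⁻¹) z (w ⁻¹) ⟩
    (x ∙ z ⁻¹) ∙ (y ⁻¹ ∙ w ⁻¹ ⁻¹)  ≈⟨ ∙-congˡ (∙-congˡ (⁻¹-involutive w)) ⟩
    (x ∙ z ⁻¹) ∙ (y ⁻¹ ∙ w)        ≈⟨ ∙-congˡ (comm (y ⁻¹) w) ⟩
    (x ∙ z ⁻¹) ∙ (w ∙ y ⁻¹)        ∎

  divide-multiply : ∀ x y z w → (x ∙ y ⁻¹) ∙ ((y ∙ z) ∙ w) ≈ (x ∙ w) ∙ z
  divide-multiply x y z w = begin
    (x ∙ y ⁻¹) ∙ ((y ∙ z) ∙ w)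
      ≈⟨ solve 5 (λ x y′ y z w → (x ⊕ y′) ⊕ ((y ⊕ z) ⊕ w) ⊜ ((x ⊕ w) ⊕ z) ⊕ (y ⊕ y′))
                 refl x (y ⁻¹) y z w ⟩
    ((x ∙ w) ∙ z) ∙ (y ∙ y ⁻¹) ≈⟨ ∙-congˡ (inverseʳ y) ⟩
    ((x ∙ w) ∙ z) ∙ ε          ≈⟨ identityʳ _ ⟩
    (x ∙ w) ∙ z                ∎

module ListProduct {a ℓ} (A : AbelianGroup a ℓ) where
  open AbelianGroup A
  open AbelianGroupProperties A using (ε⁻¹≈ε; ⁻¹-∙-comm)
  open CommutativeSemigroupProperties commutativeSemigroup using (interchange)
  open ≈-Reasoning setoid

  _when_ : ∀ {q} {Q : Set q} → Carrier → Dec Q → Carrier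
  x when yes _ = x
  x when no  _ = ε

  when-yes : ∀ {q} {Q : Set q} x (d : Dec Q) → Q → x when d ≈ x
  when-yes x (yes _) _ = refl
  when-yes x (no ¬q) q = ⊥-elim (¬q q)

  when-no : ∀ {q} {Q : Set q} x (d : Dec Q) → ¬ Q → x when d ≈ ε
  when-no x (yes q) ¬q = ⊥-elim (¬q q)
  when-no x (no _)  _  = refl

  ∏ : ∀ {i} {I : Set i} → List I → (I → Carrier) → Carrier
  ∏ L f = foldr (λ x acc → f x ∙ acc) ε L

  module _ {i} {I : Set i} where

    ∏-cong : ∀ {L : List I} {f g : I → Carrier} → All (λ x → f x ≈ g x) L → ∏ L f ≈ ∏ L g
    ∏-cong []         = refl
    ∏-cong (fx≈gx ∷ eqs) = ∙-cong fx≈gx (∏-cong eqs)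

    ∏-ε : ∀ (L : List I) → ∏ L (λ _ → ε) ≈ ε
    ∏-ε []      = refl
    ∏-ε (_ ∷ L) = trans (identityˡ _) (∏-ε L)

    ∏-∙ : ∀ L (f g : I → Carrier) → ∏ L (λ x → f x ∙ g x) ≈ ∏ L f ∙ ∏ L g
    ∏-∙ []      f g = sym (identityʳ ε)
    ∏-∙ (x ∷ L) f g = trans (∙-congˡ (∏-∙ L f g)) (interchange _ _ _ _)

    ∏-⁻¹ : ∀ L (f : I → Carrier) → ∏ L (λ x → f x ⁻¹) ≈ (∏ L f) ⁻¹
    ∏-⁻¹ []      f = sym ε⁻¹≈ε
    ∏-⁻¹ (x ∷ L) f = trans (∙-congˡ (∏-⁻¹ L f)) (⁻¹-∙-comm _ _)

    ∏-/ : ∀ L (f g : I → Carrier) → ∏ L (λ x → f x ∙ g x ⁻¹) ≈ ∏ L f ∙ (∏ L g) ⁻¹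
    ∏-/ L f g = trans (∏-∙ L f (λ x → g x ⁻¹)) (∙-congˡ (∏-⁻¹ L g))

    ∏-homo : ∀ (h : Carrier → Carrier) → h ε ≈ ε → (∀ x y → h (x ∙ y) ≈ h x ∙ h y) →
             ∀ L (f : I → Carrier) → h (∏ L f) ≈ ∏ L (λ x → h (f x))
    ∏-homo h h-ε h-∙ []      f = h-ε
    ∏-homo h h-ε h-∙ (x ∷ L) f = trans (h-∙ _ _) (∙-congˡ (∏-homo h h-ε h-∙ L f))

  ∏-comm : ∀ {i j} {I : Set i} {J : Set j} (K : List I) (L : List J) (h : I → J → Carrier) →
           ∏ K (λ x → ∏ L (h x)) ≈ ∏ L (λ y → ∏ K (λ x → h x y))
  ∏-comm []      L h = sym (∏-ε L)
  ∏-comm (x ∷ K) L h = begin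
    ∏ L (h x) ∙ ∏ K (λ x → ∏ L (h x))         ≈⟨ ∙-congˡ (∏-comm K L h) ⟩
    ∏ L (h x) ∙ ∏ L (λ y → ∏ K (λ x → h x y)) ≈⟨ ∏-∙ L (h x) _ ⟨
    ∏ L (λ y → h x y ∙ ∏ K (λ x → h x y))     ∎

module FiniteProduct {a ℓ c ℓ′} (A : AbelianGroup a ℓ) (X : Setoid c ℓ′) where
  open ListProduct A
  open AbelianGroup A using (Carrier; ε) renaming (_≈_ to _≈ᴬ_)
  private module A = AbelianGroup A
  open Setoid X renaming (Carrier to I)
  open SetoidMembership X using (_∈_)

  ∏-δ : ∀ {L x c} {f : I → Carrier} → Unique X L → x ∈ L →
        All (λ y → y ≈ x → f y ≈ᴬ c) L → All (λ y → ¬ y ≈ x → f y ≈ᴬ ε) L → ∏ L f ≈ᴬ c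
  ∏-δ {y ∷ L} {f = f} (y∉L ∷ _) (here x≈y) (at-x ∷ _) (_ ∷ off-x) =
    A.trans (A.∙-cong (at-x (sym x≈y)) (A.trans (∏-cong others) (∏-ε L))) (A.identityʳ _)
    where
    others : All (λ z → f z ≈ᴬ ε) L
    others = All.zipWith (λ (y≉z , off) → off (λ z≈x → y≉z (trans (sym x≈y) (sym z≈x))))
                         (y∉L , off-x)
  ∏-δ (y∉L ∷ unique) (there x∈L) (_ ∷ at-x) (off-y ∷ off-x) =
    A.trans (A.∙-cong (off-y (λ y≈x → All¬⇒¬Any y∉L (Any.map (trans y≈x) x∈L)))
                      (∏-δ unique x∈L at-x off-x))
            (A.identityˡ _)

  record Enumeration {p} (P : Pred I p) : Set (c ⊔ ℓ′ ⊔ p) where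
    field
      elements : List I
      unique   : Unique X elements
      sound    : All P elements
      complete : ∀ {x} → P x → x ∈ elements

  module _ {p} {P : Pred I p} (E : Enumeration P) where
    open Enumeration E

    ∏-δ-on : ∀ {x c} {f : I → Carrier} → P x →
             (∀ {y} → P y → y ≈ x → f y ≈ᴬ c) → (∀ {y} → P y → ¬ y ≈ x → f y ≈ᴬ ε) →
             ∏ elements f ≈ᴬ c
    ∏-δ-on Px at-x off-x =
      ∏-δ unique (complete Px) (All.map at-x sound) (All.map off-x sound)

    -- Both sides equal the product of f over the graph of φ, taken in either order.
    ∏-reindex : Decidable _≈_ → (φ ψ : I → I) →
                (∀ {x y} → x ≈ y → φ x ≈ φ y) → (∀ {x y} → x ≈ y → ψ x ≈ ψ y) →
                (∀ {x} → P x → P (φ x)) → (∀ {x} → P x → P (ψ x)) →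
                (∀ {x} → P x → φ (ψ x) ≈ x) → (∀ {x} → P x → ψ (φ x) ≈ x) →
                (f : I → Carrier) → (∀ {x y} → x ≈ y → f x ≈ᴬ f y) →
                ∏ elements (λ x → f (φ x)) ≈ᴬ ∏ elements f
    ∏-reindex _≟_ φ ψ φ-cong ψ-cong Pφ Pψ φψ ψφ f f-cong = begin
      ∏ elements (λ x → f (φ x))
        ≈⟨ ∏-cong (All.map (λ Px → A.sym (graph-column Px)) sound) ⟩
      ∏ elements (λ x → ∏ elements (graph x))
        ≈⟨ ∏-comm elements elements graph ⟩
      ∏ elements (λ y → ∏ elements (λ x → graph x y))
        ≈⟨ ∏-cong (All.map graph-row sound) ⟩
      ∏ elements f ∎
      where
      open ≈-Reasoning A.setoid
      graph : I → I → Carrier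
      graph x y = f y when (y ≟ φ x)
      graph-column : ∀ {x} → P x → ∏ elements (graph x) ≈ᴬ f (φ x)
      graph-column {x} Px = ∏-δ-on (Pφ Px)
        (λ {y} _ y≈φx → A.trans (when-yes (f y) (y ≟ φ x) y≈φx) (f-cong y≈φx))
        (λ {y} _ y≉φx → when-no (f y) (y ≟ φ x) y≉φx)
      graph-row : ∀ {y} → P y → ∏ elements (λ x → graph x y) ≈ᴬ f y
      graph-row {y} Py = ∏-δ-on (Pψ Py)
        (λ {x} _ x≈ψy → when-yes (f y) (y ≟ φ x) (sym (trans (φ-cong x≈ψy) (φψ Py))))
        (λ {x} Px x≉ψy → when-no (f y) (y ≟ φ x) λ y≈φx →
                            x≉ψy (sym (trans (ψ-cong y≈φx) (ψφ Px))))

module GModuleProperties {c ℓ a ℓa} {G : Group c ℓ} (M : GModule G a ℓa) where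
  open GModule M
  open AbelianGroup abelian
  open AbelianGroupProperties abelian using (identityˡ-unique; inverseʳ-unique)
  private module G = Group G

  act-ε-fixed : ∀ g → act g ε ≈ ε
  act-ε-fixed g = identityˡ-unique (act g ε) (act g ε)
    (trans (sym (act-hom g ε ε)) (act-cong G.refl (identityˡ ε)))

  act-⁻¹ : ∀ g x → act g (x ⁻¹) ≈ (act g x) ⁻¹
  act-⁻¹ g x = inverseʳ-unique (act g x) (act g (x ⁻¹))
    (trans (sym (act-hom g x (x ⁻¹))) (trans (act-cong G.refl (inverseʳ x)) (act-ε-fixed g)))

module NormalSubgroupProperties {c ℓ n} {G : FiniteGroup c ℓ} (N : NormalSubgroup G n) where
  open FiniteGroup G
  open GroupProperties group using (\\-leftDividesʳ; \\-leftDividesˡ; //-rightDividesʳ; //-rightDividesˡ;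
                                    ⁻¹-anti-homo-∙; ⁻¹-involutive)
  open NormalSubgroup N
  open ≈-Reasoning setoid

  ∈-comm : ∀ {x y} → mem (y ∙ x) → mem (x ∙ y)
  ∈-comm {x} {y} yx∈N = resp (begin
    (x ∙ (y ∙ x)) ∙ x ⁻¹ ≈⟨ ∙-congʳ (assoc x y x) ⟨
    ((x ∙ y) ∙ x) ∙ x ⁻¹ ≈⟨ //-rightDividesʳ x (x ∙ y) ⟩
    x ∙ y                ∎) (normal x yx∈N)

  ∈-sandwich : ∀ {a b m} → mem (a ∙ b) → mem m → mem ((a ∙ m) ∙ b)
  ∈-sandwich {a} {b} {m} ab∈N m∈N = resp (begin
    (a ∙ (m ∙ (b ∙ a))) ∙ a ⁻¹ ≈⟨ ∙-congʳ (∙-congˡ (assoc m b a)) ⟨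
    (a ∙ ((m ∙ b) ∙ a)) ∙ a ⁻¹ ≈⟨ ∙-congʳ (assoc a (m ∙ b) a) ⟨
    ((a ∙ (m ∙ b)) ∙ a) ∙ a ⁻¹ ≈⟨ //-rightDividesʳ a (a ∙ (m ∙ b)) ⟩
    a ∙ (m ∙ b)                ≈⟨ assoc a m b ⟨
    (a ∙ m) ∙ b                ∎) (normal a (∙∈ m∈N (∈-comm ab∈N)))

  ⁻¹-pair∈ : ∀ {a b} → mem (a ∙ b) → mem (a ⁻¹ ∙ b ⁻¹)
  ⁻¹-pair∈ {a} {b} ab∈N = resp (⁻¹-anti-homo-∙ b a) (⁻¹∈ (∈-comm ab∈N))

  sandwich-unsandwich : ∀ a b x → (a ∙ ((a ⁻¹ ∙ x) ∙ b ⁻¹)) ∙ b ≈ x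
  sandwich-unsandwich a b x = begin
    (a ∙ ((a ⁻¹ ∙ x) ∙ b ⁻¹)) ∙ b ≈⟨ ∙-congʳ (assoc a (a ⁻¹ ∙ x) (b ⁻¹)) ⟨
    ((a ∙ (a ⁻¹ ∙ x)) ∙ b ⁻¹) ∙ b ≈⟨ //-rightDividesˡ b (a ∙ (a ⁻¹ ∙ x)) ⟩
    a ∙ (a ⁻¹ ∙ x)                ≈⟨ \\-leftDividesˡ a x ⟩
    x                             ∎

  unsandwich-sandwich : ∀ a b x → (a ⁻¹ ∙ ((a ∙ x) ∙ b)) ∙ b ⁻¹ ≈ x
  unsandwich-sandwich a b x = begin
    (a ⁻¹ ∙ ((a ∙ x) ∙ b)) ∙ b ⁻¹ ≈⟨ ∙-congʳ (assoc (a ⁻¹) (a ∙ x) b) ⟨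
    ((a ⁻¹ ∙ (a ∙ x)) ∙ b) ∙ b ⁻¹ ≈⟨ //-rightDividesʳ b (a ⁻¹ ∙ (a ∙ x)) ⟩
    a ⁻¹ ∙ (a ∙ x)                ≈⟨ \\-leftDividesʳ a x ⟩
    x                             ∎

  ≈⇒~ : ∀ {x y} → x ≈ y → mem (x ⁻¹ ∙ y)
  ≈⇒~ {x} {y} x≈y = resp (sym (trans (∙-congˡ (sym x≈y)) (inverseˡ x))) ε∈

  ~-sym : ∀ {x y} → mem (x ⁻¹ ∙ y) → mem (y ⁻¹ ∙ x)
  ~-sym {x} {y} x~y = resp (trans (⁻¹-anti-homo-∙ (x ⁻¹) y) (∙-congˡ (⁻¹-involutive x))) (⁻¹∈ x~y)

  ~-·ˡ : ∀ {m} x → mem m → mem (x ⁻¹ ∙ (m ∙ x))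
  ~-·ˡ {m} x m∈N = resp (trans (assoc (x ⁻¹) m (x ⁻¹ ⁻¹)) (∙-congˡ (∙-congˡ (⁻¹-involutive x))))
                        (normal (x ⁻¹) m∈N)

module Cohomology {c ℓ n a ℓa} (G : FiniteGroup c ℓ) (N : NormalSubgroup G n)
                  (M : GModule (FiniteGroup.group G) a ℓa) where
  open Setup G N M
  private
    module G = FiniteGroup G
    module M = GModule M
    module A = AbelianGroup (GModule.abelian M)
  open ListProduct (GModule.abelian M)
  open FiniteProduct (GModule.abelian M) G.setoid
  open NormalSubgroupProperties N
  open AbelianGroupAlgebra (GModule.abelian M)
  open GModuleProperties M
  open CommutativeSemigroupProperties A.commutativeSemigroup using (interchange)
  open ≈-Reasoning A.setoid

  IsCochain1 : (∣G∣ → ∣A∣) → Set (c ⊔ ℓ ⊔ ℓa)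
  IsCochain1 β = ∀ {x y} → x ≈G y → β x ≈A β y

  δ-cong : ∀ {β β′} → (∀ x → β x ≈A β′ x) → ∀ σ τ → δ β σ τ ≈A δ β′ σ τ
  δ-cong β≈β′ σ τ =
    A.∙-cong (A.∙-cong (M.act-cong G.refl (β≈β′ τ)) (A.⁻¹-cong (β≈β′ (σ · τ)))) (β≈β′ σ)

  δ-∙ : ∀ β β′ σ τ → δ (λ x → β x * β′ x) σ τ ≈A δ β σ τ * δ β′ σ τ
  δ-∙ β β′ σ τ = begin
    (act σ (β τ * β′ τ) * (β (σ · τ) * β′ (σ · τ)) ⁻¹) * (β σ * β′ σ)
      ≈⟨ A.∙-congʳ (A.∙-congʳ (M.act-hom σ (β τ) (β′ τ))) ⟩
    ((act σ (β τ) * act σ (β′ τ)) * (β (σ · τ) * β′ (σ · τ)) ⁻¹) * (β σ * β′ σ)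
      ≈⟨ A.∙-congʳ (∙-/-interchange _ _ _ _) ⟩
    ((act σ (β τ) * β (σ · τ) ⁻¹) * (act σ (β′ τ) * β′ (σ · τ) ⁻¹)) * (β σ * β′ σ)
      ≈⟨ interchange _ _ _ _ ⟩
    δ β σ τ * δ β′ σ τ ∎

  δ-const : ∀ k σ τ → δ (λ _ → k) σ τ ≈A act σ k
  δ-const k σ τ = //-rightDividesˡ k (act σ k)
    where open AbelianGroupProperties (GModule.abelian M) using (//-rightDividesˡ)

  δ-ee : ∀ {β} → IsCochain1 β → δ β e e ≈A β e
  δ-ee {β} β-cong = begin
    (act e (β e) * β (e · e) ⁻¹) * β e ≈⟨ A.∙-congʳ (A.∙-cong (M.act-ε (β e))
                                                              (A.⁻¹-cong (β-cong (G.identityˡ e)))) ⟩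
    (β e * β e ⁻¹) * β e                ≈⟨ A.∙-congʳ (A.inverseʳ (β e)) ⟩
    1A * β e                            ≈⟨ A.identityˡ (β e) ⟩
    β e                                 ∎

  δ-Z2 : ∀ {β} → IsCochain1 β → Z2 (δ β)
  δ-Z2 {β} β-cong = cochain , cocycle
    where
    cochain : IsCochain2 (δ β)
    cochain σ≈σ′ τ≈τ′ =
      A.∙-cong (A.∙-cong (M.act-cong σ≈σ′ (β-cong τ≈τ′)) (A.⁻¹-cong (β-cong (G.∙-cong σ≈σ′ τ≈τ′))))
               (β-cong σ≈σ′)
    cocycle : CocycleId (δ β)
    cocycle σ τ ρ = begin
      act σ ((act τ (β ρ) * β (τ · ρ) ⁻¹) * β τ) * δ β σ (τ · ρ)
        ≈⟨ A.∙-congʳ (A.trans (M.act-hom σ _ _)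
                              (A.∙-congʳ (A.trans (M.act-hom σ _ _) (A.∙-congˡ (act-⁻¹ σ _))))) ⟩
      ((act σ (act τ (β ρ)) * act σ (β (τ · ρ)) ⁻¹) * act σ (β τ))
        * ((act σ (β (τ · ρ)) * β (σ · (τ · ρ)) ⁻¹) * β σ)
        ≈⟨ cancel-across _ _ _ _ _ ⟩
      (act σ (act τ (β ρ)) * act σ (β τ)) * (β (σ · (τ · ρ)) ⁻¹ * β σ)
        ≈⟨ A.∙-cong (A.∙-congʳ (M.act-∙ σ τ (β ρ)))
                    (A.∙-congʳ (A.⁻¹-cong (β-cong (G.assoc σ τ ρ)))) ⟨
      (act (σ · τ) (β ρ) * act σ (β τ)) * (β ((σ · τ) · ρ) ⁻¹ * β σ)
        ≈⟨ cancel-across′ _ _ _ _ _ ⟨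
      δ β (σ · τ) ρ * δ β σ τ ∎

  Z2-∙ : ∀ {α α′} → Z2 α → Z2 α′ → Z2 (λ σ τ → α σ τ * α′ σ τ)
  Z2-∙ {α} {α′} (α-cong , α-cocycle) (α′-cong , α′-cocycle) =
    (λ σ≈σ′ τ≈τ′ → A.∙-cong (α-cong σ≈σ′ τ≈τ′) (α′-cong σ≈σ′ τ≈τ′)) , λ σ τ ρ → begin
      act σ (α τ ρ * α′ τ ρ) * (α σ (τ · ρ) * α′ σ (τ · ρ))
        ≈⟨ A.∙-congʳ (M.act-hom σ _ _) ⟩
      (act σ (α τ ρ) * act σ (α′ τ ρ)) * (α σ (τ · ρ) * α′ σ (τ · ρ))
        ≈⟨ interchange _ _ _ _ ⟩
      (act σ (α τ ρ) * α σ (τ · ρ)) * (act σ (α′ τ ρ) * α′ σ (τ · ρ))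
        ≈⟨ A.∙-cong (α-cocycle σ τ ρ) (α′-cocycle σ τ ρ) ⟩
      (α (σ · τ) ρ * α σ τ) * (α′ (σ · τ) ρ * α′ σ τ)
        ≈⟨ interchange _ _ _ _ ⟩
      (α (σ · τ) ρ * α′ (σ · τ) ρ) * (α σ τ * α′ σ τ) ∎

  N-enumeration : Enumeration mem
  N-enumeration = record
    { elements = filter mem? Gelements
    ; unique   = UniqueProperties.filter⁺ G.setoid mem? G.distinct
    ; sound    = all-filter mem? Gelements
    ; complete = λ {x} x∈N → ∈-filter⁺ G.setoid mem? (NormalSubgroup.resp N) (G.complete x) x∈N
    }

  prodN-cong : ∀ {f g} → (∀ {m} → mem m → f m ≈A g m) → prodN f ≈A prodN g
  prodN-cong f≈g = ∏-cong (All.map f≈g (Enumeration.sound N-enumeration))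

  prodN-ε : ∀ {f} → (∀ {m} → mem m → f m ≈A 1A) → prodN f ≈A 1A
  prodN-ε f≈1 = A.trans (prodN-cong f≈1) (∏-ε (filter mem? Gelements))

  prodN-∙ : ∀ f g → prodN (λ m → f m * g m) ≈A prodN f * prodN g
  prodN-∙ = ∏-∙ (filter mem? Gelements)

  prodN-/ : ∀ f g → prodN (λ m → f m * g m ⁻¹) ≈A prodN f * prodN g ⁻¹
  prodN-/ = ∏-/ (filter mem? Gelements)

  act-prodN : ∀ σ f → act σ (prodN f) ≈A prodN (λ m → act σ (f m))
  act-prodN σ = ∏-homo (act σ) (act-ε-fixed σ) (M.act-hom σ) (filter mem? Gelements)

  prodN-sandwich : ∀ {a b} → mem (a · b) → ∀ f → IsCochain1 f →
                   prodN (λ m → f ((a · m) · b)) ≈A prodN f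
  prodN-sandwich {a} {b} ab∈N = ∏-reindex N-enumeration G._≟_
    (λ m → (a · m) · b) (λ k → (inv a · k) · inv b)
    (λ x≈y → G.∙-congʳ (G.∙-congˡ x≈y)) (λ x≈y → G.∙-congʳ (G.∙-congˡ x≈y))
    (∈-sandwich ab∈N) (∈-sandwich (⁻¹-pair∈ ab∈N))
    (λ _ → sandwich-unsandwich a b _) (λ _ → unsandwich-sandwich a b _)

  cosetProd : (∣G∣ → ∣A∣) → ∣G∣ → ∣A∣
  cosetProd f x = prodN (λ m → f (m · x))

  private
    ·ʳ-cong : ∀ {f} → IsCochain1 f → ∀ x → IsCochain1 (λ k → f (k · x))
    ·ʳ-cong f-cong x k≈k′ = f-cong (G.∙-congʳ k≈k′)

  cosetProd-~ : ∀ {f} → IsCochain1 f → ∀ {x y} → x ~ y → cosetProd f x ≈A cosetProd f y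
  cosetProd-~ {f} f-cong {x} {y} x~y = begin
    prodN (λ m → f (m · x))                       ≈⟨ prodN-cong (λ {m} _ → f-cong (regroup m)) ⟨
    prodN (λ m → f (((e · m) · (x · inv y)) · y)) ≈⟨ prodN-sandwich x/y∈N _ (·ʳ-cong f-cong y) ⟩
    prodN (λ m → f (m · y))                       ∎
    where
    open GroupProperties G.group using (//-rightDividesˡ)
    x/y∈N : mem (e · (x · inv y))
    x/y∈N = NormalSubgroup.resp N (G.sym (G.identityˡ _)) (∈-comm (~-sym x~y))
    regroup : ∀ m → ((e · m) · (x · inv y)) · y ≈G m · x
    regroup m = G.trans (G.assoc _ _ _)
                        (G.∙-cong (G.identityˡ m) (//-rightDividesˡ y x))

  prodN-·ˡ : ∀ {f} → IsCochain1 f → ∀ x → prodN (λ m → f (x · m)) ≈A cosetProd f x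
  prodN-·ˡ {f} f-cong x = begin
    prodN (λ m → f (x · m))                 ≈⟨ prodN-cong (λ {m} _ → f-cong (//-rightDividesˡ x (x · m))) ⟨
    prodN (λ m → f (((x · m) · inv x) · x)) ≈⟨ prodN-sandwich x/x∈N _ (·ʳ-cong f-cong x) ⟩
    cosetProd f x                           ∎
    where
    open GroupProperties G.group using (//-rightDividesˡ)
    x/x∈N : mem (x · inv x)
    x/x∈N = NormalSubgroup.resp N (G.sym (G.inverseʳ x)) (NormalSubgroup.ε∈ N)

  AW2-∙ : ∀ α α′ σ τ → AW2 (λ x y → α x y * α′ x y) σ τ ≈A AW2 α σ τ * AW2 α′ σ τ
  AW2-∙ α α′ σ τ = A.trans (prodN-cong (λ _ → ∙-/-interchange _ _ _ _)) (prodN-∙ _ _)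

  AW2-~ : ∀ {α} → IsCochain2 α → ∀ σ {τ τ′} → τ ~ τ′ → AW2 α σ τ ≈A AW2 α σ τ′
  AW2-~ {α} α-cong σ {τ} {τ′} τ~τ′ = begin
    AW2 α σ τ                               ≈⟨ prodN-/ _ _ ⟩
    cosetProd (α σ) τ * prodN (α σ) ⁻¹      ≈⟨ A.∙-congʳ (cosetProd-~ (α-cong G.refl) τ~τ′) ⟩
    cosetProd (α σ) τ′ * prodN (α σ) ⁻¹     ≈⟨ prodN-/ _ _ ⟨
    AW2 α σ τ′                              ∎

  AW2-unit : ∀ {α} → IsCochain2 α → ∀ σ → AW2 α σ e ≈A 1A
  AW2-unit α-cong σ = prodN-ε λ {m} _ →
    A.trans (A.∙-congˡ (A.⁻¹-cong (α-cong G.refl (G.sym (G.identityʳ m))))) (A.inverseʳ _)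

  AW2-δ : ∀ {β} → IsCochain1 β → ∀ σ τ →
          AW2 (δ β) σ τ ≈A δ (cosetProd β) σ τ * act σ (cosetProd β e) ⁻¹
  AW2-δ {β} β-cong σ τ = begin
    prodN (λ m → δ β σ (m · τ) * δ β σ m ⁻¹)
      ≈⟨ prodN-cong (λ {m} _ → A.trans (/-cancelʳ _ _ _) (/-/-rearrange _ _ _ _)) ⟩
    prodN (λ m → (act σ (β (m · τ)) * act σ (β m) ⁻¹) * (β (σ · m) * β (σ · (m · τ)) ⁻¹))
      ≈⟨ prodN-∙ _ _ ⟩
    prodN (λ m → act σ (β (m · τ)) * act σ (β m) ⁻¹) * prodN (λ m → β (σ · m) * β (σ · (m · τ)) ⁻¹)
      ≈⟨ A.∙-cong (prodN-/ _ _) (prodN-/ _ _) ⟩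
    (prodN (λ m → act σ (β (m · τ))) * prodN (λ m → act σ (β m)) ⁻¹)
      * (prodN (λ m → β (σ · m)) * prodN (λ m → β (σ · (m · τ))) ⁻¹)
      ≈⟨ A.∙-cong (A.∙-cong (A.sym (act-prodN σ _))
                            (A.⁻¹-cong (A.trans act-unit-coset (A.sym (act-prodN σ _)))))
                  (A.∙-cong (prodN-·ˡ β-cong σ) (A.⁻¹-cong left-to-right)) ⟩
    (act σ (cosetProd β τ) * act σ (cosetProd β e) ⁻¹) * (cosetProd β σ * cosetProd β (σ · τ) ⁻¹)
      ≈⟨ solve 4 (λ x y z w → (x ⊕ y) ⊕ (z ⊕ w) ⊜ ((x ⊕ w) ⊕ z) ⊕ y) A.refl
                 (act σ (cosetProd β τ)) (act σ (cosetProd β e) ⁻¹)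
                 (cosetProd β σ) (cosetProd β (σ · τ) ⁻¹) ⟩
    δ (cosetProd β) σ τ * act σ (cosetProd β e) ⁻¹ ∎
    where
    open CommutativeMonoidSolver A.commutativeMonoid using (solve; _⊜_; _⊕_)
    act-unit-coset : prodN (λ m → act σ (β m)) ≈A prodN (λ m → act σ (β (m · e)))
    act-unit-coset = prodN-cong (λ {m} _ → M.act-cong G.refl (β-cong (G.sym (G.identityʳ m))))
    left-to-right : prodN (λ m → β (σ · (m · τ))) ≈A cosetProd β (σ · τ)
    left-to-right = begin
      prodN (λ m → β (σ · (m · τ)))  ≈⟨ prodN-cong (λ {m} _ → β-cong (G.assoc σ m τ)) ⟨
      prodN (λ m → β ((σ · m) · τ))  ≈⟨ prodN-·ˡ (·ʳ-cong β-cong τ) σ ⟩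
      prodN (λ m → β ((m · σ) · τ))  ≈⟨ prodN-cong (λ {m} _ → β-cong (G.assoc m σ τ)) ⟩
      cosetProd β (σ · τ)            ∎

  leftProd : Cochain2 → ∣G∣ → ∣A∣
  leftProd α y = prodN (λ m → α m y)

  AWt-expand : ∀ {α} → CocycleId α → ∀ s σ τ →
               AWt s α σ τ ≈A (cosetProd (λ x → α x (s τ)) (s σ) * leftProd α (s σ))
                                * leftProd α (s (σ · τ)) ⁻¹
  AWt-expand {α} α-cocycle s σ τ = begin
    AWt s α σ τ
      ≈⟨ prodN-cong (λ {m} _ → A.∙-congʳ (α-cocycle m (s σ) (s τ))) ⟩
    prodN (λ m → (α (m · s σ) (s τ) * α m (s σ)) * α m (s (σ · τ)) ⁻¹)
      ≈⟨ prodN-/ _ _ ⟩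
    prodN (λ m → α (m · s σ) (s τ) * α m (s σ)) * leftProd α (s (σ · τ)) ⁻¹
      ≈⟨ A.∙-congʳ (prodN-∙ _ _) ⟩
    (cosetProd (λ x → α x (s τ)) (s σ) * leftProd α (s σ)) * leftProd α (s (σ · τ)) ⁻¹ ∎

  AW2-cocycle-expand : ∀ {α} → CocycleId α → ∀ σ y →
                       AW2 α σ y ≈A prodN (λ m → α (σ · m) y) * act σ (leftProd α y) ⁻¹
  AW2-cocycle-expand {α} α-cocycle σ y = begin
    AW2 α σ y
      ≈⟨ prodN-cong (λ {m} _ → cross-divide (α-cocycle σ m y)) ⟩
    prodN (λ m → α (σ · m) y * act σ (α m y) ⁻¹)
      ≈⟨ prodN-/ _ _ ⟩
    prodN (λ m → α (σ · m) y) * prodN (λ m → act σ (α m y)) ⁻¹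
      ≈⟨ A.∙-congˡ (A.⁻¹-cong (act-prodN σ _)) ⟨
    prodN (λ m → α (σ · m) y) * act σ (leftProd α y) ⁻¹ ∎

  AW2-cocycle : ∀ {α} → Z2 α → ∀ {s} → (∀ x → s x ~ x) → ∀ σ τ →
                AW2 α σ τ * δ (λ x → leftProd α (s x)) σ τ ≈A AWt s α σ τ
  AW2-cocycle {α} (α-cong , α-cocycle) {s} s~id σ τ = begin
    AW2 α σ τ * δ Φs σ τ
      ≈⟨ A.∙-congʳ (AW2-~ α-cong σ (~-sym (s~id τ))) ⟩
    AW2 α σ (s τ) * δ Φs σ τ
      ≈⟨ A.∙-congʳ (AW2-cocycle-expand α-cocycle σ (s τ)) ⟩
    (prodN (λ m → α (σ · m) (s τ)) * act σ (Φs τ) ⁻¹) * δ Φs σ τ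
      ≈⟨ A.∙-congʳ (A.∙-congʳ (A.trans (prodN-·ˡ column-cong σ)
                                         (cosetProd-~ column-cong (~-sym (s~id σ))))) ⟩
    (cosetProd column (s σ) * act σ (Φs τ) ⁻¹) * ((act σ (Φs τ) * Φs (σ · τ) ⁻¹) * Φs σ)
      ≈⟨ divide-multiply _ _ _ _ ⟩
    (cosetProd column (s σ) * Φs σ) * Φs (σ · τ) ⁻¹
      ≈⟨ AWt-expand α-cocycle s σ τ ⟨
    AWt s α σ τ ∎
    where
    Φs : ∣G∣ → ∣A∣
    Φs x = leftProd α (s x)
    column : ∣G∣ → ∣A∣
    column x = α x (s τ)
    column-cong : IsCochain1 column
    column-cong x≈y = α-cong x≈y G.refl

  section-cong : ∀ {s} → IsSection s → ∀ {x y} → x ≈G y → s x ≈G s y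
  section-cong section x≈y = proj₁ section (≈⇒~ x≈y)

  onSection : (∣G∣ → ∣G∣) → (∣G∣ → ∣A∣) → ∣G∣ → ∣A∣
  onSection s f x = f x when (x G.≟ s x)

  module _ {s : ∣G∣ → ∣G∣} (section : IsSection s) where
    onSection-cong : ∀ {f} → IsCochain1 f → IsCochain1 (onSection s f)
    onSection-cong {f} f-cong {x} {y} x≈y with x G.≟ s x
    ... | yes x≈sx = A.trans (f-cong x≈y) (A.sym (when-yes (f y) (y G.≟ s y) y≈sy))
      where y≈sy = G.trans (G.sym x≈y) (G.trans x≈sx (section-cong section x≈y))
    ... | no x≉sx = A.sym (when-no (f y) (y G.≟ s y) λ y≈sy →
                      x≉sx (G.trans x≈y (G.trans y≈sy (section-cong section (G.sym x≈y)))))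

    onSection-fixed : ∀ f {x} → x ≈G s x → onSection s f x ≈A f x
    onSection-fixed f {x} = when-yes (f x) (x G.≟ s x)

    -- The only fixed point of s in the coset N x is s x.
    cosetProd-onSection : ∀ {f} → IsCochain1 f → ∀ x → cosetProd (onSection s f) x ≈A f (s x)
    cosetProd-onSection {f} f-cong x =
      ∏-δ-on N-enumeration representative∈N at-representative off-representative
      where
      open GroupProperties G.group using (//-rightDividesˡ; //-rightDividesʳ)
      representative∈N : mem (s x · inv x)
      representative∈N = ∈-comm (~-sym (proj₁ (proj₂ section) x))
      s-coset : ∀ {m} → mem m → s (m · x) ≈G s x
      s-coset m∈N = proj₁ section (~-sym (~-·ˡ x m∈N))
      at-representative : ∀ {m} → mem m → m ≈G s x · inv x → onSection s f (m · x) ≈A f (s x)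
      at-representative {m} m∈N m≈ =
        A.trans (onSection-fixed f (G.trans mx≈sx (G.sym (s-coset m∈N)))) (f-cong mx≈sx)
        where
        mx≈sx : m · x ≈G s x
        mx≈sx = G.trans (G.∙-congʳ m≈) (//-rightDividesˡ x (s x))
      off-representative : ∀ {m} → mem m → ¬ m ≈G s x · inv x → onSection s f (m · x) ≈A 1A
      off-representative {m} m∈N m≉ = when-no (f (m · x)) ((m · x) G.≟ s (m · x)) λ mx≈smx →
        m≉ (G.trans (G.sym (//-rightDividesʳ x m)) (G.∙-congʳ (G.trans mx≈smx (s-coset m∈N))))

    AW2-δ-onSection : ∀ {f} → IsCochain1 f → f (s e) ≈A 1A → ∀ k σ τ →
                      AW2 (δ (onSection s (λ x → f x * k))) σ τ ≈A δ (λ x → f (s x)) σ τ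
    AW2-δ-onSection {f} f-cong fse≈1 k σ τ = begin
      AW2 (δ β) σ τ
        ≈⟨ AW2-δ (onSection-cong fk-cong) σ τ ⟩
      δ (cosetProd β) σ τ * act σ (cosetProd β e) ⁻¹
        ≈⟨ A.∙-cong (δ-cong coset σ τ) (A.⁻¹-cong (M.act-cong G.refl (coset e))) ⟩
      δ (λ x → f (s x) * k) σ τ * act σ (f (s e) * k) ⁻¹
        ≈⟨ A.∙-cong (A.trans (δ-∙ _ _ σ τ) (A.∙-congˡ (δ-const k σ τ))) (A.⁻¹-cong act-unit) ⟩
      (δ (λ x → f (s x)) σ τ * act σ k) * act σ k ⁻¹
        ≈⟨ //-rightDividesʳ (act σ k) _ ⟩
      δ (λ x → f (s x)) σ τ ∎
      where
      open AbelianGroupProperties (GModule.abelian M) using (//-rightDividesʳ)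
      β : ∣G∣ → ∣A∣
      β = onSection s (λ x → f x * k)
      fk-cong : IsCochain1 (λ x → f x * k)
      fk-cong x≈y = A.∙-congʳ (f-cong x≈y)
      coset : ∀ x → cosetProd β x ≈A f (s x) * k
      coset = cosetProd-onSection fk-cong
      act-unit : act σ (f (s e) * k) ≈A act σ k
      act-unit = begin
        act σ (f (s e) * k)       ≈⟨ M.act-hom σ _ _ ⟩
        act σ (f (s e)) * act σ k ≈⟨ A.∙-congʳ (A.trans (M.act-cong G.refl fse≈1) (act-ε-fixed σ)) ⟩
        1A * act σ k              ≈⟨ A.identityˡ _ ⟩
        act σ k                   ∎

  module Lift {α₀ : Cochain2} (α₀∈Z2 : Z2 α₀) {s : ∣G∣ → ∣G∣} (section : IsSection s)
              {αN : Cochain2} {βN : ∣G∣ → ∣A∣} (βN-cong : ∀ {x y} → x ~ y → βN x ≈A βN y)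
              (αN≈ : ∀ σ τ → αN σ τ ≈A AWt s α₀ σ τ * δ βN σ τ) (αN-unit : αN e e ≈A 1A) where

    Φ : ∣G∣ → ∣A∣
    Φ = leftProd α₀

    γ : ∣G∣ → ∣A∣
    γ x = Φ x * βN x

    β : ∣G∣ → ∣A∣
    β = onSection s (λ x → γ x * α₀ e e ⁻¹)

    lift : Cochain2
    lift σ τ = α₀ σ τ * δ β σ τ

    private
      s~id : ∀ x → s x ~ x
      s~id = proj₁ (proj₂ section)
      se≈e : s e ≈G e
      se≈e = proj₂ (proj₂ section)
      Φ-cong : IsCochain1 Φ
      Φ-cong y≈y′ = prodN-cong (λ _ → proj₁ α₀∈Z2 G.refl y≈y′)
      γ-cong : IsCochain1 γ
      γ-cong x≈y = A.∙-cong (Φ-cong x≈y) (βN-cong (≈⇒~ x≈y))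

    β-cong : IsCochain1 β
    β-cong = onSection-cong section (λ x≈y → A.∙-congʳ (γ-cong x≈y))

    lift-Z2 : Z2 lift
    lift-Z2 = Z2-∙ α₀∈Z2 (δ-Z2 β-cong)

    lift-cohomologous : Cohomologous α₀ lift
    lift-cohomologous = β , β-cong , λ _ _ → A.refl

    AWt-unit : AWt s α₀ e e ≈A Φ e
    AWt-unit = begin
      AWt s α₀ e e                         ≈⟨ AW2-cocycle α₀∈Z2 s~id e e ⟨
      AW2 α₀ e e * δ (λ x → Φ (s x)) e e   ≈⟨ A.∙-cong (AW2-unit (proj₁ α₀∈Z2) e)
                                                      (δ-ee (λ x≈y → Φ-cong (section-cong section x≈y))) ⟩
      1A * Φ (s e)                         ≈⟨ A.identityˡ _ ⟩
      Φ (s e)                              ≈⟨ Φ-cong se≈e ⟩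
      Φ e                                  ∎

    γ-unit : γ e ≈A 1A
    γ-unit = begin
      Φ e * βN e               ≈⟨ A.∙-cong AWt-unit (δ-ee (λ x≈y → βN-cong (≈⇒~ x≈y))) ⟨
      AWt s α₀ e e * δ βN e e  ≈⟨ αN≈ e e ⟨
      αN e e                   ≈⟨ αN-unit ⟩
      1A                       ∎

    lift-unit : lift e e ≈A 1A
    lift-unit = begin
      α₀ e e * δ β e e
        ≈⟨ A.∙-congˡ (δ-ee β-cong) ⟩
      α₀ e e * β e
        ≈⟨ A.∙-congˡ (onSection-fixed section (λ x → γ x * α₀ e e ⁻¹) (G.sym se≈e)) ⟩
      α₀ e e * (γ e * α₀ e e ⁻¹)
        ≈⟨ A.∙-congˡ (A.trans (A.∙-congʳ γ-unit) (A.identityˡ _)) ⟩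
      α₀ e e * α₀ e e ⁻¹
        ≈⟨ A.inverseʳ _ ⟩
      1A ∎

    AW2-lift : ∀ σ τ → AW2 lift σ τ ≈A αN σ τ
    AW2-lift σ τ = begin
      AW2 lift σ τ
        ≈⟨ AW2-∙ α₀ (δ β) σ τ ⟩
      AW2 α₀ σ τ * AW2 (δ β) σ τ
        ≈⟨ A.∙-congˡ (AW2-δ-onSection section γ-cong (A.trans (γ-cong se≈e) γ-unit) _ σ τ) ⟩
      AW2 α₀ σ τ * δ (λ x → γ (s x)) σ τ
        ≈⟨ A.∙-congˡ (δ-∙ _ _ σ τ) ⟩
      AW2 α₀ σ τ * (δ (λ x → Φ (s x)) σ τ * δ (λ x → βN (s x)) σ τ)
        ≈⟨ A.assoc _ _ _ ⟨
      (AW2 α₀ σ τ * δ (λ x → Φ (s x)) σ τ) * δ (λ x → βN (s x)) σ τ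
        ≈⟨ A.∙-cong (AW2-cocycle α₀∈Z2 s~id σ τ) (δ-cong (λ x → βN-cong (s~id x)) σ τ) ⟩
      AWt s α₀ σ τ * δ βN σ τ
        ≈⟨ αN≈ σ τ ⟨
      αN σ τ ∎

corollary3p7 : ∀ {c ℓ n a ℓa} (G : FiniteGroup c ℓ) (N : NormalSubgroup G n)
                 (M : GModule (FiniteGroup.group G) a ℓa) →
  let open Setup G N M in
  (α₀ : Cochain2) → Z2 α₀ →
  (s : ∣G∣ → ∣G∣) → IsSection s →
  (αN : Cochain2) → ZQ2 αN → CohomologousQ (AWt s α₀) αN → αN e e ≈A 1A →
  Σ Cochain2 λ α →
    Z2 α × Cohomologous α₀ α × (α e e ≈A 1A)
    × (∀ σ τ → AW2 α σ τ ≈A αN σ τ)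
corollary3p7 G N M α₀ α₀∈Z2 s section αN _ (βN , βN-cong , _ , αN≈) αN-unit =
  lift , lift-Z2 , lift-cohomologous , lift-unit , AW2-lift
  where
  open Cohomology G N M
  open Lift α₀∈Z2 section βN-cong αN≈ αN-unit
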